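{- If a formula $F$ is valid in $PASL$ (i.e. in all separation algebra models), then $F$ is provable in $LS_{PASL}$; equivalently, every formula unprovable in $LS_{PASL}$ is not $PASL$-valid.
   Context: Formulae: built from propositional variables $p$ and constants $\top,\bot,\top^*$ using $\land,\to,*,-\!*$. Labels: countably infinite set $\mathcal{L}$ with distinguished $\epsilon$. Relational atoms: $(a,b\triangleright c)$, $a=b$, $a\neq b$. Sequents $\mathcal{G};\Gamma\vdash\Delta$ with $\mathcal{G}$ a finite set of relational atoms and $\Gamma,\Delta$ finite sets of labelled formulae $a:A$. $E(\mathcal{G})\vdash a=b$ iff $(a,b)$ is in the smallest equivalence relation on $\mathcal{L}$ containing all $(c,d)$ with $c=d\in\mathcal{G}$. Base calculus $LS$ (no cut): zero-premise rules $(id)$ $\mathcal{G};\Gamma,a:p\vdash b:p,\Delta$ if $E(\mathcal{G})\vdash a=b$; $(\bot L)$; $(\top R)$; $(\top^*R)$ $\mathcal{G};\Gamma\vdash a:\top^*,\Delta$ if $E(\mathcal{G})\vdash a=\epsilon$; $(NEq)$ $\mathcal{G};\Gamma\vdash\Delta$ if $a\neq b\in\mathcal{G}$ and $E(\mathcal{G})\vdash a=b$. $(\top^*L)$: from $\mathcal{G}\cup\{a=\epsilon\};\Gamma\vdash\Delta$ infer $\mathcal{G};\Gamma,a:\top^*\vdash\Delta$. Standard $\land L,\land R,\to L,\to R$ at a fixed label. $(*L)$: from $\mathcal{G}\cup\{(x,y\triangleright z)\};\Gamma,x:A,y:B\vdash\Delta$ infer $\mathcal{G};\Gamma,z:A*B\vdash\Delta$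 ($x,y$ distinct, $\neq\epsilon$, fresh). $(-\!*R)$: from $\mathcal{G}\cup\{(x,z\triangleright y)\};\Gamma,x:A\vdash y:B,\Delta$ infer $\mathcal{G};\Gamma\vdash z:A-\!*B,\Delta$ ($x,y$ fresh). $(*R)$: if $(x,y\triangleright z)\in\mathcal{G}$, $E(\mathcal{G})\vdash z=w$: from $\mathcal{G};\Gamma\vdash x:A,w:A*B,\Delta$ and $\mathcal{G};\Gamma\vdash y:B,w:A*B,\Delta$ infer $\mathcal{G};\Gamma\vdash w:A*B,\Delta$. $(-\!*L)$: if $(x,w\triangleright y)\in\mathcal{G}$, $E(\mathcal{G})\vdash z=w$: from $\mathcal{G};\Gamma,z:A-\!*B\vdash x:A,\Delta$ and $\mathcal{G};\Gamma,z:A-\!*B,y:B\vdash\Delta$ infer $\mathcal{G};\Gamma,z:A-\!*B\vdash\Delta$. $(EM)$: from $\mathcal{G}\cup\{a=b\};\Gamma\vdash\Delta$ and $\mathcal{G}\cup\{a\neq b\};\Gamma\vdash\Delta$ infer $\mathcal{G};\Gamma\vdash\Delta$. A frame axiom $\forall\vec x.(s_1=t_1\&\cdots\& s_p=t_p\& S_1\&\cdots\& S_k\Rightarrow\exists y_1..y_n.(T_1\&\cdots\& T_l))$ yields the structural rule: for any substitution $\theta$ of labels for $\vec x$ (fixing $\epsilon$) with each $S_i\theta\in\mathcal{G}$ and $E(\mathcal{G})\vdash s_i\theta=t_i\theta$, and distinct fresh labels $b_j\neq\epsilon$ (not in the conclusion) with $\sigma=[b_j/y_j]$: from $\mathcal{G}\cup\{T_i\theta\sigma\}_i;\Gamma\vdash\Delta$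 infer $\mathcal{G};\Gamma\vdash\Delta$. $LS_{PASL}$ is $LS$ plus the rules synthesised from the six axioms: (E) $\forall x,y,z.\ y=\epsilon\ \&\ (x,y\triangleright z)\Rightarrow x=z$; (U) $\forall x.\ (x,\epsilon\triangleright x)$; (Com) $\forall x,y,z.\ (x,y\triangleright z)\Rightarrow(y,x\triangleright z)$; (A) $\forall u,y,x,v,w,y'.\ y=y'\ \&\ (u,y\triangleright x)\ \&\ (v,w\triangleright y')\Rightarrow\exists z.((z,w\triangleright x)\ \&\ (u,v\triangleright z))$; (P) $\forall w,x,y,w',x',z.\ w=w'\ \&\ x=x'\ \&\ (w,x\triangleright y)\ \&\ (w',x'\triangleright z)\Rightarrow y=z$; (C) $\forall x,y,z,x',w,z'.\ x=x'\ \&\ z=z'\ \&\ (x,y\triangleright z)\ \&\ (x',w\triangleright z')\Rightarrow y=w$. $F$ is provable if $\emptyset;\emptyset\vdash w:F$ has a derivation (finite tree) for a label $w\neq\epsilon$. Semantics: a separation algebra is $(H,\circ,\epsilon_H)$ with $\circ$ a partial binary operation that is commutative, associative, has unit $\epsilon_H$, and is cancellative ($h_1\circ h_2=h_1\circ h_4$ defined implies $h_2=h_4$); set $R(a,b,c)$ iff $a\circ b$ is defined and equals $c$ (equivalently, Kripke frames $(H,R,\epsilon_H)$ satisfying the six axioms above). With a valuation $v$: $h\Vdash p$ iff $h\in v(p)$; $\top,\bot$ as usual; $h\Vdash\top^*$ iff $h=\epsilon_H$; $\land,\to$ classical; $h\Vdash A*B$ iff $\exists h_1,h_2$ with $R(h_1,h_2,h)$,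 $h_1\Vdash A$, $h_2\Vdash B$; $h\Vdash A-\!*B$ iff for all $h_1,h_2$ with $R(h_1,h,h_2)$ and $h_1\Vdash A$, $h_2\Vdash B$. $F$ is PASL-valid iff forced at every element of every separation algebra under every valuation. -}

module Defs where

open import Data.Nat using (ℕ; zero; suc)
open import Data.List using (List; []; _∷_; _++_; concatMap)
open import Data.List.Membership.Propositional using (_∈_; _∉_)
open import Data.Product using (Σ; _×_; _,_)
open import Data.Maybe using (Maybe; just; nothing; _>>=_)
open import Data.Unit using (⊤)
open import Data.Empty using (⊥)
open import Relation.Binary.PropositionalEquality using (_≡_; _≢_)

Var : Set
Var = ℕ

infixr 6 _∧'_
infixr 5 _⇒_
infixr 7 _✱_
infixr 5 _−✱_

data Form : Set where
  var  : Var → Form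
  ⊤'   : Form
  ⊥'   : Form
  ⊤*   : Form
  _∧'_ : Form → Form → Form
  _⇒_  : Form → Form → Form
  _✱_  : Form → Form → Form
  _−✱_ : Form → Form → Form

Label : Set
Label = ℕ

ε : Label
ε = zero

data RelAtom : Set where
  tri  : Label → Label → Label → RelAtom
  eqA  : Label → Label → RelAtom
  neqA : Label → Label → RelAtom

infix 4 _∶_
data LForm : Set where
  _∶_ : Label → Form → LForm

data EqE (G : List RelAtom) : Label → Label → Set where
  e-ax    : ∀ {a b} → eqA a b ∈ G → EqE G a b
  e-refl  : ∀ {a} → EqE G a a
  e-sym   : ∀ {a b} → EqE G a b → EqE G b a
  e-trans : ∀ {a b c} → EqE G a b → EqE G b c → EqE G a c

labelsA : RelAtom → List Label
labelsA (tri a b c) = a ∷ b ∷ c ∷ []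
labelsA (eqA a b)   = a ∷ b ∷ []
labelsA (neqA a b)  = a ∷ b ∷ []

labelsL : LForm → List Label
labelsL (a ∶ _) = a ∷ []

labelsSeq : List RelAtom → List LForm → List LForm → List Label
labelsSeq G Γ Δ = concatMap labelsA G ++ concatMap labelsL Γ ++ concatMap labelsL Δ

Fresh : Label → List RelAtom → List LForm → List LForm → Set
Fresh l G Γ Δ = (l ≢ ε) × (l ∉ labelsSeq G Γ Δ)

_≈ˢ_ : {A : Set} → List A → List A → Set
xs ≈ˢ ys = (∀ {x} → x ∈ xs → x ∈ ys) × (∀ {x} → x ∈ ys → x ∈ xs)

-- The calculus LS_PASL.  Sequents G ; Γ ⊢ Δ are finite sets, represented
-- by lists taken up to set equality (rule `set-eq`); "Γ , a:A" is a:A ∷ Γ.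

data LS : List RelAtom → List LForm → List LForm → Set where
  set-eq : ∀ {G G' Γ Γ' Δ Δ'} → G ≈ˢ G' → Γ ≈ˢ Γ' → Δ ≈ˢ Δ' →
           LS G Γ Δ → LS G' Γ' Δ'
  id    : ∀ {G Γ Δ a b p} → EqE G a b →
          LS G ((a ∶ var p) ∷ Γ) ((b ∶ var p) ∷ Δ)
  ⊥L    : ∀ {G Γ Δ a} → LS G ((a ∶ ⊥') ∷ Γ) Δ
  ⊤R    : ∀ {G Γ Δ a} → LS G Γ ((a ∶ ⊤') ∷ Δ)
  ⊤*R   : ∀ {G Γ Δ a} → EqE G a ε → LS G Γ ((a ∶ ⊤*) ∷ Δ)
  NEq   : ∀ {G Γ Δ a b} → neqA a b ∈ G → EqE G a b → LS G Γ Δ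
  ⊤*L   : ∀ {G Γ Δ a} → LS (eqA a ε ∷ G) Γ Δ → LS G ((a ∶ ⊤*) ∷ Γ) Δ
  ∧L    : ∀ {G Γ Δ a A B} → LS G ((a ∶ A) ∷ (a ∶ B) ∷ Γ) Δ →
          LS G ((a ∶ A ∧' B) ∷ Γ) Δ
  ∧R    : ∀ {G Γ Δ a A B} → LS G Γ ((a ∶ A) ∷ Δ) → LS G Γ ((a ∶ B) ∷ Δ) →
          LS G Γ ((a ∶ A ∧' B) ∷ Δ)
  ⇒L    : ∀ {G Γ Δ a A B} → LS G Γ ((a ∶ A) ∷ Δ) → LS G ((a ∶ B) ∷ Γ) Δ →
          LS G ((a ∶ A ⇒ B) ∷ Γ) Δ
  ⇒R    : ∀ {G Γ Δ a A B} → LS G ((a ∶ A) ∷ Γ) ((a ∶ B) ∷ Δ) →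
          LS G Γ ((a ∶ A ⇒ B) ∷ Δ)
  ✱L    : ∀ {G Γ Δ x y z A B} → x ≢ y →
          Fresh x G ((z ∶ A ✱ B) ∷ Γ) Δ → Fresh y G ((z ∶ A ✱ B) ∷ Γ) Δ →
          LS (tri x y z ∷ G) ((x ∶ A) ∷ (y ∶ B) ∷ Γ) Δ →
          LS G ((z ∶ A ✱ B) ∷ Γ) Δ
  −✱R   : ∀ {G Γ Δ x y z A B} → x ≢ y →
          Fresh x G Γ ((z ∶ A −✱ B) ∷ Δ) → Fresh y G Γ ((z ∶ A −✱ B) ∷ Δ) →
          LS (tri x z y ∷ G) ((x ∶ A) ∷ Γ) ((y ∶ B) ∷ Δ) →
          LS G Γ ((z ∶ A −✱ B) ∷ Δ)
  ✱R    : ∀ {G Γ Δ x y z w A B} → tri x y z ∈ G → EqE G z w →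
          LS G Γ ((x ∶ A) ∷ (w ∶ A ✱ B) ∷ Δ) →
          LS G Γ ((y ∶ B) ∷ (w ∶ A ✱ B) ∷ Δ) →
          LS G Γ ((w ∶ A ✱ B) ∷ Δ)
  −✱L   : ∀ {G Γ Δ x y z w A B} → tri x w y ∈ G → EqE G z w →
          LS G ((z ∶ A −✱ B) ∷ Γ) ((x ∶ A) ∷ Δ) →
          LS G ((y ∶ B) ∷ (z ∶ A −✱ B) ∷ Γ) Δ →
          LS G ((z ∶ A −✱ B) ∷ Γ) Δ
  EM    : ∀ {G Γ Δ} (a b : Label) → LS (eqA a b ∷ G) Γ Δ → LS (neqA a b ∷ G) Γ Δ →
          LS G Γ Δ
  -- structural rules synthesised from the PASL frame axioms
  E-rule   : ∀ {G Γ Δ x y z} → tri x y z ∈ G → EqE G y ε →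
             LS (eqA x z ∷ G) Γ Δ → LS G Γ Δ
  U-rule   : ∀ {G Γ Δ} (x : Label) → LS (tri x ε x ∷ G) Γ Δ → LS G Γ Δ
  Com-rule : ∀ {G Γ Δ x y z} → tri x y z ∈ G →
             LS (tri y x z ∷ G) Γ Δ → LS G Γ Δ
  A-rule   : ∀ {G Γ Δ u y x v w y' z} → tri u y x ∈ G → tri v w y' ∈ G →
             EqE G y y' → Fresh z G Γ Δ →
             LS (tri z w x ∷ tri u v z ∷ G) Γ Δ → LS G Γ Δ
  P-rule   : ∀ {G Γ Δ w x y w' x' z} → tri w x y ∈ G → tri w' x' z ∈ G →
             EqE G w w' → EqE G x x' →
             LS (eqA y z ∷ G) Γ Δ → LS G Γ Δ
  C-rule   : ∀ {G Γ Δ x y z x' w z'} → tri x y z ∈ G → tri x' w z' ∈ G →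
             EqE G x x' → EqE G z z' →
             LS (eqA y w ∷ G) Γ Δ → LS G Γ Δ

Provable : Form → Set
Provable F = Σ Label (λ w → (w ≢ ε) × LS [] [] ((w ∶ F) ∷ []))

record SepAlg : Set₁ where
  field
    H      : Set
    _∘_    : H → H → Maybe H
    e      : H
    comm   : ∀ a b → a ∘ b ≡ b ∘ a
    assoc  : ∀ a b c → ((a ∘ b) >>= λ ab → ab ∘ c) ≡ ((b ∘ c) >>= λ bc → a ∘ bc)
    unit   : ∀ a → a ∘ e ≡ just a
    cancel : ∀ a b c d → a ∘ b ≡ just c → a ∘ d ≡ just c → b ≡ d

  R : H → H → H → Set
  R a b c = a ∘ b ≡ just c

forces : (S : SepAlg) → (Var → SepAlg.H S → Set) → SepAlg.H S → Form → Set
forces S v h (var p)  = v p h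
forces S v h ⊤'       = ⊤
forces S v h ⊥'       = ⊥
forces S v h ⊤*       = h ≡ SepAlg.e S
forces S v h (A ∧' B) = forces S v h A × forces S v h B
forces S v h (A ⇒ B)  = forces S v h A → forces S v h B
forces S v h (A ✱ B)  = Σ (SepAlg.H S) λ h₁ → Σ (SepAlg.H S) λ h₂ →
                          SepAlg.R S h₁ h₂ h × forces S v h₁ A × forces S v h₂ B
forces S v h (A −✱ B) = ∀ h₁ h₂ → SepAlg.R S h₁ h h₂ → forces S v h₁ A → forces S v h₂ B

PASL-valid : Form → Set₁
PASL-valid F = ∀ (S : SepAlg) (v : Var → SepAlg.H S → Set) (h : SepAlg.H S) → forces S v h F

-- A classical counter-model construction.  Fix an unprovable sequent s₀.
-- Each rule instance whose side conditions hold in a sequent is an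
-- "obligation"; discharging it applies the rule backwards and, by excluded
-- middle, keeps an unprovable premise, giving an unprovable extension.
-- Rounds that discharge all listed obligations (and add the unit atom
-- (k , ε ▷ k)) form an increasing chain of unprovable sequents whose limit is
-- saturated: every eventually applicable obligation is eventually fulfilled.
--
-- The limit yields a separation algebra: worlds are classes of labels under
-- limit equality, and h₁ ∘ h₂ is defined iff a limit triangle relates them.
-- Saturation under the structural rules gives the algebra laws, saturation
-- under the logical rules gives the truth lemma, so every formula on the
-- right of s₀ is falsified.  Completeness follows by excluded middle.
module Submission where

open import Defs
open import Level using (0ℓ)
open import Axiom.ExcludedMiddle using (ExcludedMiddle)
open import Function using (_∘′_)
open import Data.Nat using (ℕ; zero; suc; _⊔_; _≤_; _<_; _≤′_; ≤′-reflexive; ≤′-step)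
open import Data.Nat.Properties
  using (m≤m⊔n; m≤n⊔m; ≤-trans; ≤-refl; n≤1+n; n<1+n; <⇒≢; 1+n≰n; ≤⇒≤′; <-cmp; ≡-irrelevant)
open import Data.Nat.Induction using (<-rec)
open import Data.List using (List; []; _∷_; concat; concatMap)
open import Data.List.Extrema.Nat using (max; xs≤max)
open import Data.List.Membership.Propositional using (_∈_; lose)
open import Data.List.Membership.Propositional.Properties using (∈-concatMap⁺; ∈-concat⁺′)
open import Data.List.Relation.Unary.All as All using ()
open import Data.List.Relation.Unary.Any using (here; there)
open import Data.Maybe using (Maybe; just; nothing; _>>=_)
open import Data.Maybe.Properties using (just-injective)
open import Data.Product using (Σ; _×_; _,_; proj₁; proj₂)
open import Data.Sum using (_⊎_; inj₁; inj₂)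
open import Data.Unit using (tt)
open import Data.Empty using (⊥; ⊥-elim)
open import Relation.Binary using (tri<; tri≈; tri>)
open import Relation.Nullary using (¬_; Dec; yes; no)
open import Relation.Binary.PropositionalEquality
  using (_≡_; refl; sym; trans; cong; subst)

-- Least number principle, classically: a satisfiable predicate on ℕ has a
-- least witness.  Used to pick canonical representatives of label classes.
Least : (ℕ → Set) → Set
Least P = Σ ℕ λ m → P m × (∀ j → j < m → ¬ P j)

least : ExcludedMiddle 0ℓ → (P : ℕ → Set) → ∀ n → P n → Least P
least lem P = <-rec (λ n → P n → Least P) search
  where
  search : ∀ n → (∀ {m} → m < n → P m → Least P) → P n → Least P
  search n smaller pn with lem {Σ ℕ λ m → m < n × P m}
  ... | yes (m , m<n , pm) = smaller m<n pm
  ... | no none            = n , pn , λ j j<n pj → none (j , j<n , pj)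

least-unique : ∀ {P Q : ℕ → Set} {l₁ l₂} →
               P l₁ → (∀ j → j < l₁ → ¬ P j) → Q l₂ → (∀ j → j < l₂ → ¬ Q j) →
               (∀ {j} → P j → Q j) → (∀ {j} → Q j → P j) → l₁ ≡ l₂
least-unique {l₁ = l₁} {l₂} p₁ min₁ q₂ min₂ P⇒Q Q⇒P with <-cmp l₁ l₂
... | tri< l₁<l₂ _ _ = ⊥-elim (min₂ l₁ l₁<l₂ (P⇒Q p₁))
... | tri≈ _ l₁≡l₂ _ = l₁≡l₂
... | tri> _ _ l₂<l₁ = ⊥-elim (min₁ l₂ l₂<l₁ (Q⇒P q₂))

maybe-ext : {A : Set} (m n : Maybe A) →
            (∀ c → m ≡ just c → n ≡ just c) → (∀ c → n ≡ just c → m ≡ just c) → m ≡ n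
maybe-ext (just c) n m⇒n n⇒m = sym (m⇒n c refl)
maybe-ext nothing nothing m⇒n n⇒m = refl
maybe-ext nothing (just c) m⇒n n⇒m with n⇒m c refl
... | ()

bind-elim : {A B : Set} (m : Maybe A) (f : A → Maybe B) {d : B} →
            (m >>= f) ≡ just d → Σ A λ x → m ≡ just x × f x ≡ just d
bind-elim (just x) f e = x , refl , e

bind-intro : {A B : Set} {m : Maybe A} {f : A → Maybe B} {x : A} {d : B} →
             m ≡ just x → f x ≡ just d → (m >>= f) ≡ just d
bind-intro refl e = e

∈-concatMap : {A B : Set} (f : A → List B) {x : A} {xs : List A} {y : B} →
              x ∈ xs → y ∈ f x → y ∈ concatMap f xs
∈-concatMap f x∈xs y∈fx = ∈-concatMap⁺ f (lose x∈xs y∈fx)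

above : List Label → Label
above ls = suc (max 0 ls)

fresh-above : ∀ G Γ Δ {n} → above (labelsSeq G Γ Δ) ≤ n → Fresh n G Γ Δ
fresh-above G Γ Δ {suc n} le =
  (λ ()) , λ n∈ls → 1+n≰n (≤-trans le (All.lookup (xs≤max 0 (labelsSeq G Γ Δ)) n∈ls))

≈ˢ-refl : {A : Set} {xs : List A} → xs ≈ˢ xs
≈ˢ-refl = (λ p → p) , (λ p → p)

absorb : {A : Set} {x : A} {xs : List A} → x ∈ xs → (x ∷ xs) ≈ˢ xs
absorb x∈xs = (λ { (here refl) → x∈xs ; (there p) → p }) , there

absorb-under : {A : Set} {x y : A} {xs : List A} → x ∈ xs → (y ∷ xs) ≈ˢ (y ∷ x ∷ xs)
absorb-under x∈xs =
  (λ { (here refl) → here refl ; (there p) → there (there p) }) ,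
  (λ { (here refl) → here refl ; (there (here refl)) → there x∈xs ; (there (there p)) → there p })

contractL : ∀ {G Γ Δ x} → x ∈ Γ → LS G (x ∷ Γ) Δ → LS G Γ Δ
contractL x∈Γ = set-eq ≈ˢ-refl (absorb x∈Γ) ≈ˢ-refl

contractR : ∀ {G Γ Δ x} → x ∈ Δ → LS G Γ (x ∷ Δ) → LS G Γ Δ
contractR x∈Δ = set-eq ≈ˢ-refl ≈ˢ-refl (absorb x∈Δ)

-- Premises of ✱R and −✱L repeat their principal formula; it may be restored.
restoreL : ∀ {G Γ Δ x} → x ∈ Γ → LS G Γ Δ → LS G (x ∷ Γ) Δ
restoreL x∈Γ = set-eq ≈ˢ-refl (proj₂ (absorb x∈Γ) , proj₁ (absorb x∈Γ)) ≈ˢ-refl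

restoreL-under : ∀ {G Γ Δ x y} → x ∈ Γ → LS G (y ∷ Γ) Δ → LS G (y ∷ x ∷ Γ) Δ
restoreL-under x∈Γ = set-eq ≈ˢ-refl (absorb-under x∈Γ) ≈ˢ-refl

restoreR-under : ∀ {G Γ Δ x y} → x ∈ Δ → LS G Γ (y ∷ Δ) → LS G Γ (y ∷ x ∷ Δ)
restoreR-under x∈Δ = set-eq ≈ˢ-refl ≈ˢ-refl (absorb-under x∈Δ)

EqE-mono : ∀ {G G' a b} → (∀ {x} → x ∈ G → x ∈ G') → EqE G a b → EqE G' a b
EqE-mono G⊆G' (e-ax p)      = e-ax (G⊆G' p)
EqE-mono G⊆G' e-refl        = e-refl
EqE-mono G⊆G' (e-sym e)     = e-sym (EqE-mono G⊆G' e)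
EqE-mono G⊆G' (e-trans e f) = e-trans (EqE-mono G⊆G' e) (EqE-mono G⊆G' f)

record Sequent : Set where
  constructor ⟨_,_,_⟩
  field
    G : List RelAtom
    Γ : List LForm
    Δ : List LForm

open Sequent

Derivable : Sequent → Set
Derivable s = LS (G s) (Γ s) (Δ s)

_⊑_ : Sequent → Sequent → Set
s ⊑ s' = (∀ {x} → x ∈ G s → x ∈ G s') × (∀ {x} → x ∈ Γ s → x ∈ Γ s') ×
         (∀ {x} → x ∈ Δ s → x ∈ Δ s')

⊑-refl : ∀ {s} → s ⊑ s
⊑-refl = (λ p → p) , (λ p → p) , (λ p → p)

⊑-trans : ∀ {s t u} → s ⊑ t → t ⊑ u → s ⊑ u
⊑-trans (g , l , r) (g' , l' , r') = (λ p → g' (g p)) , (λ p → l' (l p)) , (λ p → r' (r p))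

-- Obligations: rule instances the saturation has to apply eventually.
-- `Applicable o s` is the side condition of the rule instance in s;
-- `Fulfilled o s` says that (some choice of) its premise is contained in s.

data Obligation : Set where
  rCom              : Label → Label → Label → Obligation
  rA rP rC          : Label → Label → Label → Label → Label → Label → Obligation
  r⊤*L              : Label → Obligation
  r∧L r∧R r⇒L r⇒R   : Label → Form → Form → Obligation
  r✱L r−✱R          : Label → Form → Form → Obligation
  r✱R r−✱L          : Label → Label → Label → Label → Form → Form → Obligation

Applicable : Obligation → Sequent → Set
Applicable (rCom x y z) s        = tri x y z ∈ G s
Applicable (rA u y x v w y') s   = tri u y x ∈ G s × tri v w y' ∈ G s × EqE (G s) y y'
Applicable (rP w x y w' x' z) s  =
  tri w x y ∈ G s × tri w' x' z ∈ G s × EqE (G s) w w' × EqE (G s) x x'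
Applicable (rC x y z x' w z') s  =
  tri x y z ∈ G s × tri x' w z' ∈ G s × EqE (G s) x x' × EqE (G s) z z'
Applicable (r⊤*L a) s            = (a ∶ ⊤*) ∈ Γ s
Applicable (r∧L a A B) s         = (a ∶ A ∧' B) ∈ Γ s
Applicable (r∧R a A B) s         = (a ∶ A ∧' B) ∈ Δ s
Applicable (r⇒L a A B) s         = (a ∶ A ⇒ B) ∈ Γ s
Applicable (r⇒R a A B) s         = (a ∶ A ⇒ B) ∈ Δ s
Applicable (r✱L a A B) s         = (a ∶ A ✱ B) ∈ Γ s
Applicable (r−✱R a A B) s        = (a ∶ A −✱ B) ∈ Δ s
Applicable (r✱R x y z w A B) s   = tri x y z ∈ G s × EqE (G s) z w × (w ∶ A ✱ B) ∈ Δ s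
Applicable (r−✱L x w y z A B) s  = tri x w y ∈ G s × EqE (G s) z w × (z ∶ A −✱ B) ∈ Γ s

Fulfilled : Obligation → Sequent → Set
Fulfilled (rCom x y z) s       = tri y x z ∈ G s
Fulfilled (rA u y x v w y') s  = Σ Label λ z → tri z w x ∈ G s × tri u v z ∈ G s
Fulfilled (rP w x y w' x' z) s = eqA y z ∈ G s
Fulfilled (rC x y z x' w z') s = eqA y w ∈ G s
Fulfilled (r⊤*L a) s           = eqA a ε ∈ G s
Fulfilled (r∧L a A B) s        = (a ∶ A) ∈ Γ s × (a ∶ B) ∈ Γ s
Fulfilled (r∧R a A B) s        = (a ∶ A) ∈ Δ s ⊎ (a ∶ B) ∈ Δ s
Fulfilled (r⇒L a A B) s        = (a ∶ A) ∈ Δ s ⊎ (a ∶ B) ∈ Γ s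
Fulfilled (r⇒R a A B) s        = (a ∶ A) ∈ Γ s × (a ∶ B) ∈ Δ s
Fulfilled (r✱L z A B) s        =
  Σ Label λ x → Σ Label λ y → tri x y z ∈ G s × (x ∶ A) ∈ Γ s × (y ∶ B) ∈ Γ s
Fulfilled (r−✱R z A B) s       =
  Σ Label λ x → Σ Label λ y → tri x z y ∈ G s × (x ∶ A) ∈ Γ s × (y ∶ B) ∈ Δ s
Fulfilled (r✱R x y z w A B) s  = (x ∶ A) ∈ Δ s ⊎ (y ∶ B) ∈ Δ s
Fulfilled (r−✱L x w y z A B) s = (x ∶ A) ∈ Δ s ⊎ (y ∶ B) ∈ Γ s

applicable-mono : ∀ o {s s'} → s ⊑ s' → Applicable o s → Applicable o s'
applicable-mono (rCom _ _ _)       (g , l , r) p               = g p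
applicable-mono (rA _ _ _ _ _ _)   (g , l , r) (p , q , e)     = g p , g q , EqE-mono g e
applicable-mono (rP _ _ _ _ _ _)   (g , l , r) (p , q , e , f) = g p , g q , EqE-mono g e , EqE-mono g f
applicable-mono (rC _ _ _ _ _ _)   (g , l , r) (p , q , e , f) = g p , g q , EqE-mono g e , EqE-mono g f
applicable-mono (r⊤*L _)           (g , l , r) p               = l p
applicable-mono (r∧L _ _ _)        (g , l , r) p               = l p
applicable-mono (r∧R _ _ _)        (g , l , r) p               = r p
applicable-mono (r⇒L _ _ _)        (g , l , r) p               = l p
applicable-mono (r⇒R _ _ _)        (g , l , r) p               = r p
applicable-mono (r✱L _ _ _)        (g , l , r) p               = l p
applicable-mono (r−✱R _ _ _)       (g , l , r) p               = r p
applicable-mono (r✱R _ _ _ _ _ _)  (g , l , r) (p , e , q)     = g p , EqE-mono g e , r q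
applicable-mono (r−✱L _ _ _ _ _ _) (g , l , r) (p , e , q)     = g p , EqE-mono g e , l q

fulfilled-mono : ∀ o {s s'} → s ⊑ s' → Fulfilled o s → Fulfilled o s'
fulfilled-mono (rCom _ _ _)       (g , l , r) p                     = g p
fulfilled-mono (rA _ _ _ _ _ _)   (g , l , r) (z , p , q)           = z , g p , g q
fulfilled-mono (rP _ _ _ _ _ _)   (g , l , r) p                     = g p
fulfilled-mono (rC _ _ _ _ _ _)   (g , l , r) p                     = g p
fulfilled-mono (r⊤*L _)           (g , l , r) p                     = g p
fulfilled-mono (r∧L _ _ _)        (g , l , r) (p , q)               = l p , l q
fulfilled-mono (r∧R _ _ _)        (g , l , r) (inj₁ p)              = inj₁ (r p)
fulfilled-mono (r∧R _ _ _)        (g , l , r) (inj₂ p)              = inj₂ (r p)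
fulfilled-mono (r⇒L _ _ _)        (g , l , r) (inj₁ p)              = inj₁ (r p)
fulfilled-mono (r⇒L _ _ _)        (g , l , r) (inj₂ p)              = inj₂ (l p)
fulfilled-mono (r⇒R _ _ _)        (g , l , r) (p , q)               = l p , r q
fulfilled-mono (r✱L _ _ _)        (g , l , r) (x , y , p , q , q')  = x , y , g p , l q , l q'
fulfilled-mono (r−✱R _ _ _)       (g , l , r) (x , y , p , q , q')  = x , y , g p , l q , r q'
fulfilled-mono (r✱R _ _ _ _ _ _)  (g , l , r) (inj₁ p)              = inj₁ (r p)
fulfilled-mono (r✱R _ _ _ _ _ _)  (g , l , r) (inj₂ p)              = inj₂ (r p)
fulfilled-mono (r−✱L _ _ _ _ _ _) (g , l , r) (inj₁ p)              = inj₁ (r p)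
fulfilled-mono (r−✱L _ _ _ _ _ _) (g , l , r) (inj₂ p)              = inj₂ (l p)

fromAtom : RelAtom → List Obligation
fromAtom (tri x y z) = rCom x y z ∷ []
fromAtom _           = []

fromAtoms : RelAtom → RelAtom → List Obligation
fromAtoms (tri a b c) (tri a' b' c') = rA a b c a' b' c' ∷ rP a b c a' b' c' ∷ rC a b c a' b' c' ∷ []
fromAtoms _ _                        = []

fromLeft : LForm → List Obligation
fromLeft (a ∶ ⊤*)     = r⊤*L a ∷ []
fromLeft (a ∶ A ∧' B) = r∧L a A B ∷ []
fromLeft (a ∶ A ⇒ B)  = r⇒L a A B ∷ []
fromLeft (a ∶ A ✱ B)  = r✱L a A B ∷ []
fromLeft _            = []

fromRight : LForm → List Obligation
fromRight (a ∶ A ∧' B) = r∧R a A B ∷ []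
fromRight (a ∶ A ⇒ B)  = r⇒R a A B ∷ []
fromRight (a ∶ A −✱ B) = r−✱R a A B ∷ []
fromRight _            = []

fromLeftAtom : LForm → RelAtom → List Obligation
fromLeftAtom (z ∶ A −✱ B) (tri x w y) = r−✱L x w y z A B ∷ []
fromLeftAtom _ _                      = []

fromRightAtom : LForm → RelAtom → List Obligation
fromRightAtom (w ∶ A ✱ B) (tri x y z) = r✱R x y z w A B ∷ []
fromRightAtom _ _                     = []

pairsWith : List RelAtom → RelAtom → List Obligation
pairsWith G a = concatMap (fromAtoms a) G

leftWith : List RelAtom → LForm → List Obligation
leftWith G f = concatMap (fromLeftAtom f) G

rightWith : List RelAtom → LForm → List Obligation
rightWith G f = concatMap (fromRightAtom f) G

generators : Sequent → List (List Obligation)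
generators s =
    concatMap fromAtom (G s)
  ∷ concatMap (pairsWith (G s)) (G s)
  ∷ concatMap fromLeft (Γ s)
  ∷ concatMap fromRight (Δ s)
  ∷ concatMap (leftWith (G s)) (Γ s)
  ∷ concatMap (rightWith (G s)) (Δ s)
  ∷ []

obligations : Sequent → List Obligation
obligations s = concat (generators s)

generated : ∀ {o os} s → o ∈ os → os ∈ generators s → o ∈ obligations s
generated s o∈os os∈gen = ∈-concat⁺′ {xss = generators s} o∈os os∈gen

listed : ∀ o s → Applicable o s → o ∈ obligations s
listed (rCom _ _ _) s p = generated s (∈-concatMap fromAtom p (here refl)) (here refl)
listed (rA _ _ _ _ _ _) s (p , q , _) = generated s
  (∈-concatMap (pairsWith (G s)) p (∈-concatMap (fromAtoms _) q (here refl))) (there (here refl))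
listed (rP _ _ _ _ _ _) s (p , q , _) = generated s
  (∈-concatMap (pairsWith (G s)) p (∈-concatMap (fromAtoms _) q (there (here refl))))
  (there (here refl))
listed (rC _ _ _ _ _ _) s (p , q , _) = generated s
  (∈-concatMap (pairsWith (G s)) p (∈-concatMap (fromAtoms _) q (there (there (here refl)))))
  (there (here refl))
listed (r⊤*L _) s p     = generated s (∈-concatMap fromLeft p (here refl)) (there (there (here refl)))
listed (r∧L _ _ _) s p  = generated s (∈-concatMap fromLeft p (here refl)) (there (there (here refl)))
listed (r⇒L _ _ _) s p  = generated s (∈-concatMap fromLeft p (here refl)) (there (there (here refl)))
listed (r✱L _ _ _) s p  = generated s (∈-concatMap fromLeft p (here refl)) (there (there (here refl)))
listed (r∧R _ _ _) s p  =
  generated s (∈-concatMap fromRight p (here refl)) (there (there (there (here refl))))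
listed (r⇒R _ _ _) s p  =
  generated s (∈-concatMap fromRight p (here refl)) (there (there (there (here refl))))
listed (r−✱R _ _ _) s p =
  generated s (∈-concatMap fromRight p (here refl)) (there (there (there (here refl))))
listed (r−✱L _ _ _ _ _ _) s (p , _ , q) = generated s
  (∈-concatMap (leftWith (G s)) q (∈-concatMap (fromLeftAtom _) p (here refl)))
  (there (there (there (there (here refl)))))
listed (r✱R _ _ _ _ _ _) s (p , _ , q) = generated s
  (∈-concatMap (rightWith (G s)) q (∈-concatMap (fromRightAtom _) p (here refl)))
  (there (there (there (there (there (here refl))))))

module Discharging (lem : ExcludedMiddle 0ℓ) where

  record Discharge (o : Obligation) (s : Sequent) : Set where
    constructor discharged
    field
      next       : Sequent
      unprovable : ¬ Derivable next
      extends    : s ⊑ next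
      fulfils    : Applicable o s → Fulfilled o next

  byRule : ∀ {o s} s' → (Derivable s' → Derivable s) → s ⊑ s' → Fulfilled o s' →
           ¬ Derivable s → Discharge o s
  byRule s' rule s⊑s' done unprov = discharged s' (λ d → unprov (rule d)) s⊑s' (λ _ → done)

  -- A two-premise rule: one of the premises is unprovable; excluded middle picks it.
  byRule₂ : ∀ {o s} s₁ s₂ → (Derivable s₁ → Derivable s₂ → Derivable s) →
            s ⊑ s₁ → s ⊑ s₂ → Fulfilled o s₁ → Fulfilled o s₂ → ¬ Derivable s → Discharge o s
  byRule₂ s₁ s₂ rule s⊑s₁ s⊑s₂ done₁ done₂ unprov with lem {Derivable s₁}
  ... | no unprov₁ = discharged s₁ unprov₁ s⊑s₁ (λ _ → done₁)
  ... | yes d₁     = discharged s₂ (λ d₂ → unprov (rule d₁ d₂)) s⊑s₂ (λ _ → done₂)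

  addG : ∀ {G Γ Δ} a → ⟨ G , Γ , Δ ⟩ ⊑ ⟨ a ∷ G , Γ , Δ ⟩
  addG a = there , (λ p → p) , (λ p → p)

  addΓ : ∀ {G Γ Δ} a → ⟨ G , Γ , Δ ⟩ ⊑ ⟨ G , a ∷ Γ , Δ ⟩
  addΓ a = (λ p → p) , there , (λ p → p)

  addΔ : ∀ {G Γ Δ} a → ⟨ G , Γ , Δ ⟩ ⊑ ⟨ G , Γ , a ∷ Δ ⟩
  addΔ a = (λ p → p) , (λ p → p) , there

  discharge : ∀ o s → ¬ Derivable s → Discharge o s
  discharge o s unprov with lem {Applicable o s}
  ... | no n/a = discharged s unprov ⊑-refl (λ p → ⊥-elim (n/a p))
  discharge (rCom x y z) ⟨ G , Γ , Δ ⟩ unprov | yes p =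
    byRule ⟨ tri y x z ∷ G , Γ , Δ ⟩ (Com-rule p) (addG _) (here refl) unprov
  discharge (rA u y x v w y') ⟨ G , Γ , Δ ⟩ unprov | yes (p , q , e) =
    let z = above (labelsSeq G Γ Δ) in
    byRule ⟨ tri z w x ∷ tri u v z ∷ G , Γ , Δ ⟩ (A-rule p q e (fresh-above G Γ Δ ≤-refl))
           ((λ r → there (there r)) , (λ r → r) , (λ r → r)) (z , here refl , there (here refl)) unprov
  discharge (rP w x y w' x' z) ⟨ G , Γ , Δ ⟩ unprov | yes (p , q , e , f) =
    byRule ⟨ eqA y z ∷ G , Γ , Δ ⟩ (P-rule p q e f) (addG _) (here refl) unprov
  discharge (rC x y z x' w z') ⟨ G , Γ , Δ ⟩ unprov | yes (p , q , e , f) =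
    byRule ⟨ eqA y w ∷ G , Γ , Δ ⟩ (C-rule p q e f) (addG _) (here refl) unprov
  discharge (r⊤*L a) ⟨ G , Γ , Δ ⟩ unprov | yes p =
    byRule ⟨ eqA a ε ∷ G , Γ , Δ ⟩ (contractL p ∘′ ⊤*L) (addG _) (here refl) unprov
  discharge (r∧L a A B) ⟨ G , Γ , Δ ⟩ unprov | yes p =
    byRule ⟨ G , (a ∶ A) ∷ (a ∶ B) ∷ Γ , Δ ⟩ (contractL p ∘′ ∧L)
           ((λ r → r) , (λ r → there (there r)) , (λ r → r)) (here refl , there (here refl)) unprov
  discharge (r∧R a A B) ⟨ G , Γ , Δ ⟩ unprov | yes p =
    byRule₂ ⟨ G , Γ , (a ∶ A) ∷ Δ ⟩ ⟨ G , Γ , (a ∶ B) ∷ Δ ⟩ (λ d₁ d₂ → contractR p (∧R d₁ d₂))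
            (addΔ _) (addΔ _) (inj₁ (here refl)) (inj₂ (here refl)) unprov
  discharge (r⇒L a A B) ⟨ G , Γ , Δ ⟩ unprov | yes p =
    byRule₂ ⟨ G , Γ , (a ∶ A) ∷ Δ ⟩ ⟨ G , (a ∶ B) ∷ Γ , Δ ⟩ (λ d₁ d₂ → contractL p (⇒L d₁ d₂))
            (addΔ _) (addΓ _) (inj₁ (here refl)) (inj₂ (here refl)) unprov
  discharge (r⇒R a A B) ⟨ G , Γ , Δ ⟩ unprov | yes p =
    byRule ⟨ G , (a ∶ A) ∷ Γ , (a ∶ B) ∷ Δ ⟩ (contractR p ∘′ ⇒R)
           ((λ r → r) , there , there) (here refl , here refl) unprov
  discharge (r✱L z A B) ⟨ G , Γ , Δ ⟩ unprov | yes p =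
    let x = above (labelsSeq G ((z ∶ A ✱ B) ∷ Γ) Δ) in
    byRule ⟨ tri x (suc x) z ∷ G , (x ∶ A) ∷ (suc x ∶ B) ∷ Γ , Δ ⟩
           (contractL p ∘′ ✱L (<⇒≢ (n<1+n x)) (fresh-above G ((z ∶ A ✱ B) ∷ Γ) Δ ≤-refl)
                                         (fresh-above G ((z ∶ A ✱ B) ∷ Γ) Δ (n≤1+n x)))
           (there , (λ r → there (there r)) , (λ r → r))
           (x , suc x , here refl , here refl , there (here refl)) unprov
  discharge (r−✱R z A B) ⟨ G , Γ , Δ ⟩ unprov | yes p =
    let x = above (labelsSeq G Γ ((z ∶ A −✱ B) ∷ Δ)) in
    byRule ⟨ tri x z (suc x) ∷ G , (x ∶ A) ∷ Γ , (suc x ∶ B) ∷ Δ ⟩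
           (contractR p ∘′ −✱R (<⇒≢ (n<1+n x)) (fresh-above G Γ ((z ∶ A −✱ B) ∷ Δ) ≤-refl)
                                          (fresh-above G Γ ((z ∶ A −✱ B) ∷ Δ) (n≤1+n x)))
           (there , there , there) (x , suc x , here refl , here refl , here refl) unprov
  discharge (r✱R x y z w A B) ⟨ G , Γ , Δ ⟩ unprov | yes (t , e , p) =
    byRule₂ ⟨ G , Γ , (x ∶ A) ∷ Δ ⟩ ⟨ G , Γ , (y ∶ B) ∷ Δ ⟩
            (λ d₁ d₂ → contractR p (✱R t e (restoreR-under p d₁) (restoreR-under p d₂)))
            (addΔ _) (addΔ _) (inj₁ (here refl)) (inj₂ (here refl)) unprov
  discharge (r−✱L x w y z A B) ⟨ G , Γ , Δ ⟩ unprov | yes (t , e , p) =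
    byRule₂ ⟨ G , Γ , (x ∶ A) ∷ Δ ⟩ ⟨ G , (y ∶ B) ∷ Γ , Δ ⟩
            (λ d₁ d₂ → contractL p (−✱L t e (restoreL p d₁) (restoreL-under p d₂)))
            (addΔ _) (addΓ _) (inj₁ (here refl)) (inj₂ (here refl)) unprov

  record Round (os : List Obligation) (s : Sequent) : Set where
    constructor done
    field
      next       : Sequent
      unprovable : ¬ Derivable next
      extends    : s ⊑ next
      fulfils    : ∀ {o} → o ∈ os → Applicable o s → Fulfilled o next

  -- Discharge the obligations one after another; fulfilment persists.
  round : ∀ os s → ¬ Derivable s → Round os s
  round [] s unprov = done s unprov ⊑-refl (λ ())
  round (o ∷ os) s unprov with discharge o s unprov
  ... | discharged s₁ unprov₁ s⊑s₁ fulfils₁ with round os s₁ unprov₁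
  ...   | done s₂ unprov₂ s₁⊑s₂ fulfils₂ = done s₂ unprov₂ (⊑-trans s⊑s₁ s₁⊑s₂) fulfils
    where
    fulfils : ∀ {o'} → o' ∈ o ∷ os → Applicable o' s → Fulfilled o' s₂
    fulfils (here refl) app = fulfilled-mono o s₁⊑s₂ (fulfils₁ app)
    fulfils (there o'∈os) app = fulfils₂ o'∈os (applicable-mono _ s⊑s₁ app)

module Saturation (lem : ExcludedMiddle 0ℓ) (s₀ : Sequent) (unprov₀ : ¬ Derivable s₀) where
  open Discharging lem

  withUnit : ℕ → Sequent → Sequent
  withUnit k ⟨ G , Γ , Δ ⟩ = ⟨ tri k ε k ∷ G , Γ , Δ ⟩

  -- Stage k+1 adds the unit atom (k , ε ▷ k) to stage k and then discharges
  -- every obligation listed at stage k.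
  stage : ℕ → Σ Sequent λ s → ¬ Derivable s
  roundAt : ∀ k → Round (obligations (proj₁ (stage k))) (withUnit k (proj₁ (stage k)))

  stage zero    = s₀ , unprov₀
  stage (suc k) = Round.next (roundAt k) , Round.unprovable (roundAt k)
  roundAt k     = round _ _ (λ d → proj₂ (stage k) (U-rule k d))

  S : ℕ → Sequent
  S k = proj₁ (stage k)

  unprovable : ∀ k → ¬ Derivable (S k)
  unprovable k = proj₂ (stage k)

  unit-atom : ∀ k → tri k ε k ∈ G (S (suc k))
  unit-atom k = proj₁ (Round.extends (roundAt k)) (here refl)

  step : ∀ k → S k ⊑ S (suc k)
  step k = ⊑-trans (addG (tri k ε k)) (Round.extends (roundAt k))

  chain : ∀ {k m} → k ≤ m → S k ⊑ S m
  chain = chain′ ∘′ ≤⇒≤′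
    where
    chain′ : ∀ {k m} → k ≤′ m → S k ⊑ S m
    chain′ (≤′-reflexive refl)      = ⊑-refl
    chain′ {m = suc m} (≤′-step le) = ⊑-trans (chain′ le) (step m)

  fair : ∀ o k → Applicable o (S k) → Fulfilled o (S (suc k))
  fair o k app = Round.fulfils (roundAt k) (listed o (S k) app)
                   (applicable-mono o (addG (tri k ε k)) app)

  -- Truth in the limit: P holds at some stage.  Persistent properties that
  -- hold in the limit hold jointly in the limit.
  Eventually : (Sequent → Set) → Set
  Eventually P = Σ ℕ λ k → P (S k)

  Persistent : (Sequent → Set) → Set
  Persistent P = ∀ {s s'} → s ⊑ s' → P s → P s'

  both : ∀ {P Q : Sequent → Set} → Persistent P → Persistent Q →
         Eventually P → Eventually Q → Eventually (λ s → P s × Q s)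
  both pP pQ (k , p) (m , q) = k ⊔ m , pP (chain (m≤m⊔n k m)) p , pQ (chain (m≤n⊔m k m)) q

  _×ᵖ_ : ∀ {P Q : Sequent → Set} → Persistent P → Persistent Q → Persistent (λ s → P s × Q s)
  (pP ×ᵖ pQ) le (p , q) = pP le p , pQ le q

  inG-persists : ∀ {a} → Persistent (λ s → a ∈ G s)
  inG-persists le p = proj₁ le p

  inΓ-persists : ∀ {f} → Persistent (λ s → f ∈ Γ s)
  inΓ-persists le p = proj₁ (proj₂ le) p

  inΔ-persists : ∀ {f} → Persistent (λ s → f ∈ Δ s)
  inΔ-persists le p = proj₂ (proj₂ le) p

  EqE-persists : ∀ {a b} → Persistent (λ s → EqE (G s) a b)
  EqE-persists le e = EqE-mono (proj₁ le) e

  saturated : ∀ o → Eventually (Applicable o) → Eventually (Fulfilled o)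
  saturated o (k , app) = suc k , fair o k app

  inG : RelAtom → Set
  inG a = Eventually (λ s → a ∈ G s)

  inΓ inΔ : LForm → Set
  inΓ f = Eventually (λ s → f ∈ Γ s)
  inΔ f = Eventually (λ s → f ∈ Δ s)

  _~_ : Label → Label → Set
  a ~ b = Eventually (λ s → EqE (G s) a b)

  ~-refl : ∀ {a} → a ~ a
  ~-refl = 0 , e-refl

  ~-sym : ∀ {a b} → a ~ b → b ~ a
  ~-sym (k , e) = k , e-sym e

  ~-trans : ∀ {a b c} → a ~ b → b ~ c → a ~ c
  ~-trans p q with both EqE-persists EqE-persists p q
  ... | k , e , f = k , e-trans e f

  ~-atom : ∀ {a b} → inG (eqA a b) → a ~ b
  ~-atom (k , p) = k , e-ax p

  not-id : ∀ {a b p} → inΓ (a ∶ var p) → inΔ (b ∶ var p) → ¬ a ~ b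
  not-id l r e with both inΓ-persists (inΔ-persists ×ᵖ EqE-persists) l (both inΔ-persists EqE-persists r e)
  ... | k , l' , r' , e' = unprovable k (contractR r' (contractL l' (id e')))

  not-⊥L : ∀ {a} → ¬ inΓ (a ∶ ⊥')
  not-⊥L (k , l) = unprovable k (contractL l ⊥L)

  not-⊤R : ∀ {a} → ¬ inΔ (a ∶ ⊤')
  not-⊤R (k , r) = unprovable k (contractR r ⊤R)

  not-⊤*R : ∀ {a} → inΔ (a ∶ ⊤*) → ¬ a ~ ε
  not-⊤*R r e with both inΔ-persists EqE-persists r e
  ... | k , r' , e' = unprovable k (contractR r' (⊤*R e'))

module Countermodel (lem : ExcludedMiddle 0ℓ) (s₀ : Sequent) (unprov₀ : ¬ Derivable s₀) where
  open Saturation lem s₀ unprov₀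

  -- Worlds are the classes of labels under limit equality, each represented
  -- by its least member.  The choice is kept abstract: only its
  -- specification is used, and unfolding it would only slow down checking.
  abstract
    representative : ∀ a → Least (_~ a)
    representative a = least lem (_~ a) a ~-refl

  rep : Label → Label
  rep a = proj₁ (representative a)

  rep~ : ∀ a → rep a ~ a
  rep~ a = proj₁ (proj₂ (representative a))

  rep-resp : ∀ {a b} → a ~ b → rep a ≡ rep b
  rep-resp {a} {b} a~b =
    least-unique (rep~ a) (proj₂ (proj₂ (representative a)))
                 (rep~ b) (proj₂ (proj₂ (representative b)))
                 (λ j~a → ~-trans j~a a~b) (λ j~b → ~-trans j~b (~-sym a~b))

  World : Set
  World = Σ Label λ a → rep a ≡ a

  [_] : Label → World
  [ a ] = rep a , rep-resp (rep~ a)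

  -- Worlds are determined by their representative (the proof part is a
  -- proposition), so a label determines its world up to limit equality.
  world-≡ : {h h' : World} → proj₁ h ≡ proj₁ h' → h ≡ h'
  world-≡ {a , p} {.a , q} refl = cong (a ,_) (≡-irrelevant p q)

  ~-[] : ∀ a → a ~ proj₁ [ a ]
  ~-[] a = ~-sym (rep~ a)

  []-resp : ∀ {a b} → a ~ b → [ a ] ≡ [ b ]
  []-resp a~b = world-≡ (rep-resp a~b)

  []-of : ∀ {a} (h : World) → a ~ proj₁ h → [ a ] ≡ h
  []-of h a~h = world-≡ (trans (rep-resp a~h) (proj₂ h))

  []-member : ∀ {a} {h : World} → [ a ] ≡ h → a ~ proj₁ h
  []-member {a} refl = ~-[] a

  []-inj : ∀ {a b} → [ a ] ≡ [ b ] → a ~ b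
  []-inj {a} {b} eq = ~-trans ([]-member eq) (rep~ b)

  -- The limit frame satisfies the frame axioms P, C, Com and A, by saturation
  -- under the corresponding structural rules.
  Tri : Label → Label → Label → Set
  Tri x y z = inG (tri x y z)

  jointly : ∀ {t t' a b c d} → inG t → inG t' → a ~ b → c ~ d →
                  Eventually (λ s → t ∈ G s × t' ∈ G s × EqE (G s) a b × EqE (G s) c d)
  jointly p q e f =
    both inG-persists (inG-persists ×ᵖ (EqE-persists ×ᵖ EqE-persists)) p
      (both inG-persists (EqE-persists ×ᵖ EqE-persists) q (both EqE-persists EqE-persists e f))

  partial-function : ∀ {w x y w' x' z} → Tri w x y → Tri w' x' z → w ~ w' → x ~ x' → y ~ z
  partial-function t t' e f = ~-atom (saturated (rP _ _ _ _ _ _) (jointly t t' e f))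

  cancellative : ∀ {x y z x' w z'} → Tri x y z → Tri x' w z' → x ~ x' → z ~ z' → y ~ w
  cancellative t t' e f = ~-atom (saturated (rC _ _ _ _ _ _) (jointly t t' e f))

  commutative : ∀ {x y z} → Tri x y z → Tri y x z
  commutative t = saturated (rCom _ _ _) t

  associative : ∀ {u y x v w y'} → Tri u y x → Tri v w y' → y ~ y' →
                Σ Label λ z → Tri z w x × Tri u v z
  associative t t' e
    with saturated (rA _ _ _ _ _ _)
           (both inG-persists (inG-persists ×ᵖ EqE-persists) t (both inG-persists EqE-persists t' e))
  ... | k , z , p , q = z , (k , p) , (k , q)

  -- h ∘ h' is defined iff some limit triangle has inputs in the classes h, h';
  -- its value is then the class of the output (unique by partial-function).
  Composable : Label → Label → Set
  Composable a b = Σ Label λ x → Σ Label λ y → Σ Label λ z → Tri x y z × x ~ a × y ~ b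

  compose : (a b : Label) → Dec (Composable a b) → Maybe World
  compose a b (yes (x , y , z , _)) = just [ z ]
  compose a b (no _)                = nothing

  _∘_ : World → World → Maybe World
  h ∘ h' = compose (proj₁ h) (proj₁ h') lem

  compose-intro : ∀ {x y z a b} → Tri x y z → x ~ a → y ~ b →
                  (d : Dec (Composable a b)) → compose a b d ≡ just [ z ]
  compose-intro t ex ey (yes (x' , y' , z' , t' , ex' , ey')) =
    cong just ([]-resp (partial-function t' t (~-trans ex' (~-sym ex)) (~-trans ey' (~-sym ey))))
  compose-intro t ex ey (no none) = ⊥-elim (none (_ , _ , _ , t , ex , ey))

  ∘-intro : ∀ {x y z} {h h' : World} → Tri x y z → x ~ proj₁ h → y ~ proj₁ h' → h ∘ h' ≡ just [ z ]
  ∘-intro t ex ey = compose-intro t ex ey lem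

  Witness : Label → Label → World → Set
  Witness a b c = Σ Label λ x → Σ Label λ y → Σ Label λ z → Tri x y z × x ~ a × y ~ b × [ z ] ≡ c

  compose-elim : ∀ {a b c} (d : Dec (Composable a b)) → compose a b d ≡ just c → Witness a b c
  compose-elim (yes (x , y , z , t , ex , ey)) eq = x , y , z , t , ex , ey , just-injective eq

  ∘-elim : ∀ {h h' c : World} → h ∘ h' ≡ just c → Witness (proj₁ h) (proj₁ h') c
  ∘-elim = compose-elim lem

  ε-world : World
  ε-world = [ ε ]

  ∘-comm-defined : ∀ (a b : World) c → a ∘ b ≡ just c → b ∘ a ≡ just c
  ∘-comm-defined a b c ab≡c with ∘-elim {a} {b} ab≡c
  ... | x , y , z , t , ex , ey , z≡c = trans (∘-intro {h = b} {h' = a} (commutative t) ey ex) (cong just z≡c)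

  ∘-comm : ∀ a b → a ∘ b ≡ b ∘ a
  ∘-comm a b = maybe-ext _ _ (∘-comm-defined a b) (∘-comm-defined b a)

  -- (a ∘ b) ∘ c = d implies (c ∘ b) ∘ a = d: the axiom A applied to the
  -- commuted triangles of the two compositions.
  ∘-rotate : ∀ a b c d → ((a ∘ b) >>= λ ab → ab ∘ c) ≡ just d → ((c ∘ b) >>= λ cb → cb ∘ a) ≡ just d
  ∘-rotate a b c d abc≡d with bind-elim (a ∘ b) (λ ab → ab ∘ c) abc≡d
  ... | ab , ab≡ , abc≡ with ∘-elim {a} {b} ab≡ | ∘-elim {ab} {c} abc≡
  ... | x , y , z , t₁ , xa , yb , z≡ab | z' , w' , u , t₂ , z'ab , w'c , u≡d
    with associative (commutative t₂) (commutative t₁) (~-trans z'ab (~-sym ([]-member z≡ab)))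
  ... | s , t₃ , t₄ =
    bind-intro {m = c ∘ b} (∘-intro {h = c} {h' = b} t₄ w'c yb)
               (trans (∘-intro {h = [ s ]} {h' = a} t₃ (~-[] s) xa) (cong just u≡d))

  ∘-flip : ∀ a b c d → ((c ∘ b) >>= λ cb → cb ∘ a) ≡ just d → ((b ∘ c) >>= λ bc → a ∘ bc) ≡ just d
  ∘-flip a b c d cba≡d with bind-elim (c ∘ b) (λ cb → cb ∘ a) cba≡d
  ... | cb , cb≡ , cba≡ = bind-intro {m = b ∘ c} (∘-comm-defined c b cb cb≡) (∘-comm-defined cb a d cba≡)

  ∘-unflip : ∀ a b c d → ((b ∘ c) >>= λ bc → a ∘ bc) ≡ just d → ((c ∘ b) >>= λ cb → cb ∘ a) ≡ just d
  ∘-unflip a b c d abc≡d with bind-elim (b ∘ c) (λ bc → a ∘ bc) abc≡d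
  ... | bc , bc≡ , abc≡ = bind-intro {m = c ∘ b} (∘-comm-defined b c bc bc≡) (∘-comm-defined a bc d abc≡)

  ∘-assoc : ∀ a b c → ((a ∘ b) >>= λ ab → ab ∘ c) ≡ ((b ∘ c) >>= λ bc → a ∘ bc)
  ∘-assoc a b c = maybe-ext _ _ (λ d eq → ∘-flip a b c d (∘-rotate a b c d eq))
                                (λ d eq → ∘-rotate c b a d (∘-unflip a b c d eq))

  -- The unit atoms (k , ε ▷ k) added at every stage make [ ε ] a unit.
  ∘-unit : ∀ a → a ∘ ε-world ≡ just a
  ∘-unit a = trans (∘-intro {h = a} {h' = ε-world} (suc (proj₁ a) , unit-atom (proj₁ a)) ~-refl (~-[] ε))
                   (cong just ([]-of a ~-refl))

  ∘-cancel : ∀ a b c d → a ∘ b ≡ just c → a ∘ d ≡ just c → b ≡ d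
  ∘-cancel a b c d ab≡c ad≡c with ∘-elim {a} {b} ab≡c | ∘-elim {a} {d} ad≡c
  ... | x , y , z , t , xa , yb , z≡c | x' , y' , z' , t' , x'a , y'd , z'≡c =
    trans (sym ([]-of b yb))
          (trans ([]-resp (cancellative t t' (~-trans xa (~-sym x'a)) ([]-inj (trans z≡c (sym z'≡c)))))
                 ([]-of d y'd))

  model : SepAlg
  model = record { H = World ; _∘_ = _∘_ ; e = ε-world ; comm = ∘-comm ; assoc = ∘-assoc
                 ; unit = ∘-unit ; cancel = ∘-cancel }

  valuation : Var → World → Set
  valuation p h = Σ Label λ a → inΓ (a ∶ var p) × [ a ] ≡ h

  _⊩_ : World → Form → Set
  h ⊩ A = forces model valuation h A

  Truth : Form → Set
  Truth A = ∀ a → (inΓ (a ∶ A) → [ a ] ⊩ A) × (inΔ (a ∶ A) → ¬ [ a ] ⊩ A)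

  truth-var : ∀ p → Truth (var p)
  truth-var p a = (λ l → a , l , refl) , λ { r (b , l , b≡a) → not-id l r ([]-inj b≡a) }

  truth-⊤* : Truth ⊤*
  truth-⊤* a = (λ l → []-resp (~-atom (saturated (r⊤*L a) l))) , λ r a≡ε → not-⊤*R r ([]-inj a≡ε)

  truth-∧ : ∀ {A B} → Truth A → Truth B → Truth (A ∧' B)
  truth-∧ {A} {B} TA TB a = holds , fails
    where
    holds : inΓ (a ∶ A ∧' B) → [ a ] ⊩ (A ∧' B)
    holds l with saturated (r∧L a A B) l
    ... | k , p , q = proj₁ (TA a) (k , p) , proj₁ (TB a) (k , q)

    fails : inΔ (a ∶ A ∧' B) → ¬ [ a ] ⊩ (A ∧' B)
    fails r (fa , fb) with saturated (r∧R a A B) r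
    ... | k , inj₁ p = proj₂ (TA a) (k , p) fa
    ... | k , inj₂ q = proj₂ (TB a) (k , q) fb

  truth-⇒ : ∀ {A B} → Truth A → Truth B → Truth (A ⇒ B)
  truth-⇒ {A} {B} TA TB a = holds , fails
    where
    holds : inΓ (a ∶ A ⇒ B) → [ a ] ⊩ (A ⇒ B)
    holds l fa with saturated (r⇒L a A B) l
    ... | k , inj₁ p = ⊥-elim (proj₂ (TA a) (k , p) fa)
    ... | k , inj₂ q = proj₁ (TB a) (k , q)

    fails : inΔ (a ∶ A ⇒ B) → ¬ [ a ] ⊩ (A ⇒ B)
    fails r f with saturated (r⇒R a A B) r
    ... | k , p , q = proj₂ (TB a) (k , q) (f (proj₁ (TA a) (k , p)))

  truth-✱ : ∀ {A B} → Truth A → Truth B → Truth (A ✱ B)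
  truth-✱ {A} {B} TA TB a = holds , fails
    where
    holds : inΓ (a ∶ A ✱ B) → [ a ] ⊩ (A ✱ B)
    holds l with saturated (r✱L a A B) l
    ... | k , x , y , t , p , q =
      [ x ] , [ y ] , ∘-intro {h = [ x ]} {h' = [ y ]} (k , t) (~-[] x) (~-[] y) ,
      proj₁ (TA x) (k , p) , proj₁ (TB y) (k , q)

    fails : inΔ (a ∶ A ✱ B) → ¬ [ a ] ⊩ (A ✱ B)
    fails r (h₁ , h₂ , h₁h₂≡a , f₁ , f₂) with ∘-elim {h₁} {h₂} h₁h₂≡a
    ... | x , y , z , t , x~h₁ , y~h₂ , z≡a
      with saturated (r✱R x y z a A B)
             (both inG-persists (EqE-persists ×ᵖ inΔ-persists) t
                   (both EqE-persists inΔ-persists ([]-inj z≡a) r))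
    ... | k , inj₁ p = proj₂ (TA x) (k , p) (subst (_⊩ A) (sym ([]-of h₁ x~h₁)) f₁)
    ... | k , inj₂ q = proj₂ (TB y) (k , q) (subst (_⊩ B) (sym ([]-of h₂ y~h₂)) f₂)

  truth-−✱ : ∀ {A B} → Truth A → Truth B → Truth (A −✱ B)
  truth-−✱ {A} {B} TA TB a = holds , fails
    where
    holds : inΓ (a ∶ A −✱ B) → [ a ] ⊩ (A −✱ B)
    holds l h₁ h₂ h₁a≡h₂ f₁ with ∘-elim {h₁} {[ a ]} h₁a≡h₂
    ... | x , y , z , t , x~h₁ , y~a , z≡h₂
      with saturated (r−✱L x y z a A B)
             (both inG-persists (EqE-persists ×ᵖ inΓ-persists) t
                   (both EqE-persists inΓ-persists (~-sym (~-trans y~a (rep~ a))) l))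
    ... | k , inj₁ p = ⊥-elim (proj₂ (TA x) (k , p) (subst (_⊩ A) (sym ([]-of h₁ x~h₁)) f₁))
    ... | k , inj₂ q = subst (_⊩ B) z≡h₂ (proj₁ (TB z) (k , q))

    fails : inΔ (a ∶ A −✱ B) → ¬ [ a ] ⊩ (A −✱ B)
    fails r f with saturated (r−✱R a A B) r
    ... | k , x , y , t , p , q =
      proj₂ (TB y) (k , q)
        (f [ x ] [ y ] (∘-intro {h = [ x ]} {h' = [ a ]} (k , t) (~-[] x) (~-[] a)) (proj₁ (TA x) (k , p)))

  truth : ∀ A → Truth A
  truth (var p)  = truth-var p
  truth ⊤'       = λ a → (λ _ → tt) , λ r _ → not-⊤R r
  truth ⊥'       = λ a → (λ l → ⊥-elim (not-⊥L l)) , λ _ ()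
  truth ⊤*       = truth-⊤*
  truth (A ∧' B) = truth-∧ (truth A) (truth B)
  truth (A ⇒ B)  = truth-⇒ (truth A) (truth B)
  truth (A ✱ B)  = truth-✱ (truth A) (truth B)
  truth (A −✱ B) = truth-−✱ (truth A) (truth B)

  refutes : ∀ {a A} → (a ∶ A) ∈ Δ s₀ → ¬ [ a ] ⊩ A
  refutes {a} {A} r = proj₂ (truth A a) (0 , r)

unprovable-refutable :
  ExcludedMiddle 0ℓ → ∀ {s a A} → ¬ Derivable s → (a ∶ A) ∈ Δ s →
  Σ SepAlg λ S → Σ (Var → SepAlg.H S → Set) λ v → Σ (SepAlg.H S) λ h → ¬ forces S v h A
unprovable-refutable lem {s} {a} unprov r = model , valuation , [ a ] , refutes r
  where open Countermodel lem s unprov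

corollary3p12 : ExcludedMiddle 0ℓ → (F : Form) → PASL-valid F → Provable F
corollary3p12 lem F valid with lem {Provable F}
... | yes provable = provable
... | no unprovable
  with unprovable-refutable lem {⟨ [] , [] , (1 ∶ F) ∷ [] ⟩} (λ d → unprovable (1 , (λ ()) , d)) (here refl)
...   | S , v , h , fails = ⊥-elim (fails (valid S v h))
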